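{- Let $\underrightarrow{G}=(V,E,\omega)$ be a directed graph with positive edge weights in which every vertex has positive weighted in-degree $\deg^-(v)$. Let $S\subseteq V$ be nonempty with $\Psi(S)/|S|\le\frac12$, where $\Psi(S)=\sum_{v\in S}\sum_{(u,v)\in E,\,u\in S}\frac{\omega((u,v))}{\deg^-(v)}$. Then there is a subset $S'\subseteq S$ with $|S'|\ge\frac14|S|$ such that for every $s\in S'$, $$\sum_{(v,s)\in E,\,v\notin S}\omega((v,s))\ge\frac14\deg^-(s).$$
   Formalization: The positive edge weights ω of the directed graph are rational. -}

module Defs where

open import Data.Nat using (ℕ; zero; suc)
open import Data.Bool using (Bool; true; false; if_then_else_; _∧_; not)
open import Data.Fin using (Fin; zero; suc)
open import Data.Fin.Subset using (Subset)
open import Data.Vec using (lookup)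
open import Data.Rational using (ℚ; 0ℚ; _+_; _÷_; _>_; positive)
open import Data.Rational.Properties using (pos⇒nonZero)

Σ : ∀ {n} → (Fin n → ℚ) → ℚ
Σ {zero}  f = 0ℚ
Σ {suc n} f = f zero + Σ (λ i → f (suc i))

-- Weighted directed graph on vertex set Fin n:
--   E u v = true  iff  (u , v) is an edge;  ω u v is the weight of (u , v)
--   (only meaningful when E u v = true).
record WDigraph (n : ℕ) : Set where
  field
    E : Fin n → Fin n → Bool
    ω : Fin n → Fin n → ℚ

open WDigraph public

edgeW : ∀ {n} → WDigraph n → Bool → Fin n → Fin n → ℚ
edgeW G b u v = if E G u v ∧ b then ω G u v else 0ℚ

deg⁻ : ∀ {n} → WDigraph n → Fin n → ℚ
deg⁻ G v = Σ (λ u → edgeW G true u v)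

div : (p q : ℚ) → q > 0ℚ → ℚ
div p q q>0 = _÷_ p q {{pos⇒nonZero q {{positive q>0}}}}

Ψ : ∀ {n} (G : WDigraph n) → (∀ v → deg⁻ G v > 0ℚ) → Subset n → ℚ
Ψ G degpos S =
  Σ (λ v → if lookup S v
           then div (Σ (λ u → edgeW G (lookup S u) u v)) (deg⁻ G v) (degpos v)
           else 0ℚ)

inFromOutside : ∀ {n} → WDigraph n → Subset n → Fin n → ℚ
inFromOutside G S s = Σ (λ v → edgeW G (not (lookup S v)) v s)

{-# OPTIONS --safe #-}
-- For v ∈ S the share ψ(v) of deg⁻(v) coming from inside S lies in [0,1], and
-- Ψ(S) = Σ_{v ∈ S} ψ(v). A vertex of S receiving less than a quarter of its
-- in-weight from outside S has ψ(v) > 3/4, so (3/4)|S| ≤ Ψ(S) + (3/4)|S′| where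
-- S′ collects the remaining vertices of S. With Ψ(S) ≤ |S|/2 this gives
-- |S|/4 ≤ (3/4)|S′| ≤ |S′|.
module Submission where

open import Defs
open import Level using (0ℓ)
open import Function using (_∘_)
open import Data.Nat using (ℕ; zero; suc)
open import Data.Bool using (Bool; true; false; if_then_else_; _∧_; not)
open import Data.Fin using (Fin; zero; suc)
open import Data.Fin.Subset using (Subset; _⊆_; _∈_; ∣_∣; Nonempty; _∩_)
open import Data.Fin.Subset.Properties using (p∩q⊆p; x∈p∩q⁻)
open import Data.Vec using ([]; _∷_; lookup; tabulate)
open import Data.Vec.Properties using ([]=⇒lookup; lookup∘tabulate; lookup-zipWith)
open import Data.Integer as ℤ using (+_)
open import Data.Integer.Tactic.RingSolver using (solve-∀)
open import Data.Rational
  using (ℚ; 0ℚ; 1ℚ; ½; _/_; _+_; _*_; -_; 1/_; _≤_; _<_; _>_; _≤?_; toℚᵘ; NonZero; Positive; positive; nonNegative)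
open import Data.Rational.Properties
import Data.Rational.Unnormalised as ℚᵘ
import Data.Rational.Unnormalised.Properties as ℚᵘ
open import Data.Rational.Solver using (module +-*-Solver)
open import Data.Product using (∃; _×_; _,_; proj₂)
open import Relation.Binary.PropositionalEquality
  using (_≡_; refl; sym; trans; cong; cong₂; subst; subst₂; _≗_; module ≡-Reasoning)
open import Relation.Nullary using (Dec; yes; no; ¬_; does)
open import Relation.Unary using (Pred; Decidable)
open import Algebra.Bundles using (CommutativeRing)
open import Algebra.Properties.CommutativeMonoid.Sum (CommutativeRing.+-commutativeMonoid +-*-commutativeRing)
  using (sum; sum-cong-≗; sum-replicate-zero; ∑-distrib-+)
open import Algebra.Properties.Semiring.Sum (CommutativeRing.semiring +-*-commutativeRing)
  using (*-distribˡ-sum)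

¼ ¾ : ℚ
¼ = + 1 / 4
¾ = + 3 / 4

fromℕ : ℕ → ℚ
fromℕ k = + k / 1

-- _/_ normalises by a gcd that does not compute on variables, so identities
-- involving it are proved in ℚᵘ, where they reduce to integer identities.
toℚᵘ-/ : ∀ i n → toℚᵘ (i / suc n) ℚᵘ.≃ ℚᵘ.mkℚᵘ i n
toℚᵘ-/ i n = toℚᵘ-fromℚᵘ (ℚᵘ.mkℚᵘ i n)

fromℕ-suc : ∀ k → fromℕ (suc k) ≡ 1ℚ + fromℕ k
fromℕ-suc k = toℚᵘ-injective (begin-equality
  toℚᵘ (fromℕ (suc k))           ≃⟨ toℚᵘ-/ (+ suc k) 0 ⟩
  ℚᵘ.mkℚᵘ (+ suc k) 0            ≃⟨ ℚᵘ.*≡* (cross-multiplied (+ k)) ⟩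
  toℚᵘ 1ℚ ℚᵘ.+ ℚᵘ.mkℚᵘ (+ k) 0   ≃⟨ ℚᵘ.+-congʳ (toℚᵘ 1ℚ) (toℚᵘ-/ (+ k) 0) ⟨
  toℚᵘ 1ℚ ℚᵘ.+ toℚᵘ (fromℕ k)    ≃⟨ toℚᵘ-homo-+ 1ℚ (fromℕ k) ⟨
  toℚᵘ (1ℚ + fromℕ k)            ∎)
  where
  open ℚᵘ.≤-Reasoning
  cross-multiplied : ∀ x → (+ 1 ℤ.+ x) ℤ.* (+ 1 ℤ.* + 1) ≡ (+ 1 ℤ.* + 1 ℤ.+ x ℤ.* + 1) ℤ.* + 1
  cross-multiplied = solve-∀

k/4≡¼*k : ∀ k → + k / 4 ≡ ¼ * fromℕ k
k/4≡¼*k k = toℚᵘ-injective (begin-equality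
  toℚᵘ (+ k / 4)                ≃⟨ toℚᵘ-/ (+ k) 3 ⟩
  ℚᵘ.mkℚᵘ (+ k) 3               ≃⟨ ℚᵘ.*≡* (cross-multiplied (+ k)) ⟩
  toℚᵘ ¼ ℚᵘ.* ℚᵘ.mkℚᵘ (+ k) 0   ≃⟨ ℚᵘ.*-congˡ {toℚᵘ ¼} (toℚᵘ-/ (+ k) 0) ⟨
  toℚᵘ ¼ ℚᵘ.* toℚᵘ (fromℕ k)    ≃⟨ toℚᵘ-homo-* ¼ (fromℕ k) ⟨
  toℚᵘ (¼ * fromℕ k)            ∎)
  where
  open ℚᵘ.≤-Reasoning
  cross-multiplied : ∀ x → x ℤ.* + 4 ≡ (+ 1 ℤ.* x) ℤ.* + 4
  cross-multiplied = solve-∀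

fromℕ-nonNeg : ∀ k → 0ℚ ≤ fromℕ k
fromℕ-nonNeg k = nonNegative⁻¹ (fromℕ k) {{normalize-nonNeg k 1}}

p≤q+p : ∀ {p q} → 0ℚ ≤ q → p ≤ q + p
p≤q+p {p} {q} 0≤q = subst (_≤ q + p) (+-identityˡ p) (+-monoˡ-≤ p 0≤q)

+-cancelʳ-≤ : ∀ r {p q} → p + r ≤ q + r → p ≤ q
+-cancelʳ-≤ r {p} {q} p+r≤q+r =
  subst₂ _≤_ (+-inverseʳ-cancel p) (+-inverseʳ-cancel q) (+-monoˡ-≤ (- r) p+r≤q+r)
  where
  +-inverseʳ-cancel : ∀ x → x + r + - r ≡ x
  +-inverseʳ-cancel x = trans (+-assoc x r (- r)) (trans (cong (_+_ x) (+-inverseʳ r)) (+-identityʳ x))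

div-nonNeg : ∀ {a d} (d>0 : d > 0ℚ) → 0ℚ ≤ a → 0ℚ ≤ div a d d>0
div-nonNeg {a} {d} d>0 0≤a =
  nonNegative⁻¹ _ {{nonNeg*nonNeg⇒nonNeg a {{nonNegative 0≤a}} (1/ d) {{pos⇒nonNeg (1/ d) {{1/pos⇒pos d}}}}}}
  where
  instance
    d-pos : Positive d
    d-pos = positive d>0
    d≢0 : NonZero d
    d≢0 = pos⇒nonZero d

b<e*d⇒c≤a/d : ∀ {a b c d e} (d>0 : d > 0ℚ) → c + e ≡ 1ℚ → d ≡ a + b → b < e * d → c ≤ div a d d>0
b<e*d⇒c≤a/d {a} {b} {c} {d} {e} d>0 c+e≡1 d≡a+b b<ed =
  *-cancelʳ-≤-pos d (subst (c * d ≤_) (sym a/d*d≡a) (+-cancelʳ-≤ (e * d) cd+ed≤a+ed))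
  where
  instance
    d-pos : Positive d
    d-pos = positive d>0
    d≢0 : NonZero d
    d≢0 = pos⇒nonZero d
  cd+ed≡d : c * d + e * d ≡ d
  cd+ed≡d = trans (sym (*-distribʳ-+ d c e)) (trans (cong (_* d) c+e≡1) (*-identityˡ d))
  cd+ed≤a+ed : c * d + e * d ≤ a + e * d
  cd+ed≤a+ed = subst₂ _≤_ (sym cd+ed≡d) refl (subst (_≤ a + e * d) (sym d≡a+b) (+-monoʳ-≤ a (<⇒≤ b<ed)))
  a/d*d≡a : div a d d>0 * d ≡ a
  a/d*d≡a = begin
    a * 1/ d * d   ≡⟨ *-assoc a (1/ d) d ⟩
    a * (1/ d * d) ≡⟨ cong (_*_ a) (*-inverseˡ d) ⟩
    a * 1ℚ         ≡⟨ *-identityʳ a ⟩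
    a              ∎
    where open ≡-Reasoning

¼*x≤y : ∀ {x y} → 0ℚ ≤ y → ¾ * x ≤ ½ * x + ¾ * y → ¼ * x ≤ y
¼*x≤y {x} {y} 0≤y ¾x≤½x+¾y = ≤-trans ¼x≤¾y ¾y≤y
  where
  open +-*-Solver
  ¼x≤¾y : ¼ * x ≤ ¾ * y
  ¼x≤¾y = +-cancelʳ-≤ (½ * x)
    (subst₂ _≤_ (solve 1 (λ x → con ¾ :* x := con ¼ :* x :+ con ½ :* x) refl x)
                (+-comm (½ * x) (¾ * y)) ¾x≤½x+¾y)
  ¾y≤y : ¾ * y ≤ y
  ¾y≤y = subst (¾ * y ≤_) (solve 1 (λ y → con ¼ :* y :+ con ¾ :* y := y) refl y)
           (p≤q+p (*-monoˡ-≤-nonNeg ¼ 0≤y))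

Σ≡sum : ∀ {n} (f : Fin n → ℚ) → Σ f ≡ sum f
Σ≡sum {zero}  f = refl
Σ≡sum {suc n} f = cong (_+_ (f zero)) (Σ≡sum (f ∘ suc))

Σ-cong : ∀ {n} {f g : Fin n → ℚ} → f ≗ g → Σ f ≡ Σ g
Σ-cong {f = f} {g} f≗g = trans (Σ≡sum f) (trans (sum-cong-≗ f≗g) (sym (Σ≡sum g)))

Σ-distrib-+ : ∀ {n} (f g : Fin n → ℚ) → Σ (λ i → f i + g i) ≡ Σ f + Σ g
Σ-distrib-+ f g = begin
  Σ (λ i → f i + g i)      ≡⟨ Σ≡sum (λ i → f i + g i) ⟩
  sum (λ i → f i + g i)    ≡⟨ ∑-distrib-+ f g ⟩
  sum f + sum g            ≡⟨ cong₂ _+_ (Σ≡sum f) (Σ≡sum g) ⟨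
  Σ f + Σ g                ∎
  where open ≡-Reasoning

*-distribˡ-Σ : ∀ {n} c (f : Fin n → ℚ) → c * Σ f ≡ Σ (λ i → c * f i)
*-distribˡ-Σ c f = begin
  c * Σ f               ≡⟨ cong (_*_ c) (Σ≡sum f) ⟩
  c * sum f             ≡⟨ *-distribˡ-sum c f ⟩
  sum (λ i → c * f i)   ≡⟨ Σ≡sum (λ i → c * f i) ⟨
  Σ (λ i → c * f i)     ∎
  where open ≡-Reasoning

Σ-mono-≤ : ∀ {n} {f g : Fin n → ℚ} → (∀ i → f i ≤ g i) → Σ f ≤ Σ g
Σ-mono-≤ {zero}  f≤g = ≤-refl
Σ-mono-≤ {suc n} f≤g = +-mono-≤ (f≤g zero) (Σ-mono-≤ (f≤g ∘ suc))

Σ-nonNeg : ∀ {n} {f : Fin n → ℚ} → (∀ i → 0ℚ ≤ f i) → 0ℚ ≤ Σ f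
Σ-nonNeg {n} {f} 0≤f = subst (_≤ Σ f) Σ0≡0 (Σ-mono-≤ 0≤f)
  where
  Σ0≡0 : Σ {n} (λ _ → 0ℚ) ≡ 0ℚ
  Σ0≡0 = trans (Σ≡sum {n} (λ _ → 0ℚ)) (sum-replicate-zero n)

indicator : Bool → ℚ
indicator b = if b then 1ℚ else 0ℚ

Σ-indicator : ∀ {n} (p : Subset n) → Σ (indicator ∘ lookup p) ≡ fromℕ ∣ p ∣
Σ-indicator []           = refl
Σ-indicator (true  ∷ p) = trans (cong (_+_ 1ℚ) (Σ-indicator p)) (sym (fromℕ-suc ∣ p ∣))
Σ-indicator (false ∷ p) = trans (+-identityˡ _) (Σ-indicator p)

Σ-scaled-indicator : ∀ {n} c (p : Subset n) → Σ (λ i → c * indicator (lookup p i)) ≡ c * fromℕ ∣ p ∣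
Σ-scaled-indicator c p = trans (sym (*-distribˡ-Σ c (indicator ∘ lookup p))) (cong (_*_ c) (Σ-indicator p))

indicator-∧-bound : ∀ {P : Set} b (P? : Dec P) {c r} → 0ℚ ≤ r → (¬ P → c ≤ r) →
                    c * indicator b ≤ (if b then r else 0ℚ) + c * indicator (b ∧ does P?)
indicator-∧-bound false P?      {c} 0≤r c≤r = ≤-reflexive (sym (+-identityˡ (c * 0ℚ)))
indicator-∧-bound true  (yes _)     0≤r c≤r = p≤q+p 0≤r
indicator-∧-bound true  (no ¬p) {c} {r} 0≤r c≤r = begin
  c * 1ℚ       ≡⟨ *-identityʳ c ⟩
  c            ≤⟨ c≤r ¬p ⟩
  r            ≡⟨ +-identityʳ r ⟨
  r + 0ℚ       ≡⟨ cong (_+_ r) (*-zeroʳ c) ⟨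
  r + c * 0ℚ   ∎
  where open ≤-Reasoning

subsetOf : ∀ {n} {P : Pred (Fin n) 0ℓ} → Decidable P → Subset n
subsetOf P? = tabulate (does ∘ P?)

∈-subsetOf⁻ : ∀ {n} {P : Pred (Fin n) 0ℓ} (P? : Decidable P) {x} → x ∈ subsetOf P? → P x
∈-subsetOf⁻ P? {x} x∈ with P? x | trans (sym (lookup∘tabulate (does ∘ P?) x)) ([]=⇒lookup x∈)
... | yes Px | _  = Px
... | no  _  | ()

lookup-∩-subsetOf : ∀ {n} (p : Subset n) {P : Pred (Fin n) 0ℓ} (P? : Decidable P) x →
                    lookup (p ∩ subsetOf P?) x ≡ lookup p x ∧ does (P? x)
lookup-∩-subsetOf p P? x =
  trans (lookup-zipWith _∧_ x p (subsetOf P?)) (cong (_∧_ (lookup p x)) (lookup∘tabulate (does ∘ P?) x))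

inFromInside : ∀ {n} → WDigraph n → Subset n → Fin n → ℚ
inFromInside G S v = Σ (λ u → edgeW G (lookup S u) u v)

edgeW-nonNeg : ∀ {n} (G : WDigraph n) → (∀ u v → E G u v ≡ true → 0ℚ ≤ ω G u v) →
               ∀ b u v → 0ℚ ≤ edgeW G b u v
edgeW-nonNeg G ω≥0 b u v with E G u v in uv∈E | b
... | false | _     = ≤-refl
... | true  | false = ≤-refl
... | true  | true  = ω≥0 u v uv∈E

edgeW-split : ∀ {n} (G : WDigraph n) b u v → edgeW G true u v ≡ edgeW G b u v + edgeW G (not b) u v
edgeW-split G b u v with E G u v | b
... | false | _     = refl
... | true  | false = sym (+-identityˡ (ω G u v))
... | true  | true  = sym (+-identityʳ (ω G u v))

deg⁻-split : ∀ {n} (G : WDigraph n) S v → deg⁻ G v ≡ inFromInside G S v + inFromOutside G S v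
deg⁻-split G S v =
  trans (Σ-cong (λ u → edgeW-split G (lookup S u) u v))
        (Σ-distrib-+ (λ u → edgeW G (lookup S u) u v) (λ u → edgeW G (not (lookup S u)) u v))

fedFromOutside? : ∀ {n} (G : WDigraph n) S → Decidable (λ v → ¼ * deg⁻ G v ≤ inFromOutside G S v)
fedFromOutside? G S v = ¼ * deg⁻ G v ≤? inFromOutside G S v

¾∣S∣≤Ψ+¾∣S∩fed∣ : ∀ {n} (G : WDigraph n) → (∀ u v → E G u v ≡ true → 0ℚ ≤ ω G u v) →
                   (degpos : ∀ v → deg⁻ G v > 0ℚ) (S : Subset n) →
                   ¾ * fromℕ ∣ S ∣ ≤ Ψ G degpos S + ¾ * fromℕ ∣ S ∩ subsetOf (fedFromOutside? G S) ∣
¾∣S∣≤Ψ+¾∣S∩fed∣ G ω≥0 degpos S = begin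
  ¾ * fromℕ ∣ S ∣                                ≡⟨ Σ-scaled-indicator ¾ S ⟨
  Σ (λ v → ¾ * indicator (lookup S v))            ≤⟨ Σ-mono-≤ pointwise ⟩
  Σ (λ v → ψ v + ¾ * indicator (lookup S′ v))     ≡⟨ Σ-distrib-+ ψ (λ v → ¾ * indicator (lookup S′ v)) ⟩
  Ψ G degpos S + Σ (λ v → ¾ * indicator (lookup S′ v))
                                                  ≡⟨ cong (_+_ (Ψ G degpos S)) (Σ-scaled-indicator ¾ S′) ⟩
  Ψ G degpos S + ¾ * fromℕ ∣ S′ ∣                ∎
  where
  open ≤-Reasoning
  S′ : Subset _
  S′ = S ∩ subsetOf (fedFromOutside? G S)
  ψ : Fin _ → ℚ
  ψ v = if lookup S v then div (inFromInside G S v) (deg⁻ G v) (degpos v) else 0ℚ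
  pointwise : ∀ v → ¾ * indicator (lookup S v) ≤ ψ v + ¾ * indicator (lookup S′ v)
  pointwise v =
    subst (λ b → ¾ * indicator (lookup S v) ≤ ψ v + ¾ * indicator b)
          (sym (lookup-∩-subsetOf S (fedFromOutside? G S) v))
      (indicator-∧-bound (lookup S v) (fedFromOutside? G S v)
        (div-nonNeg (degpos v) (Σ-nonNeg (λ u → edgeW-nonNeg G ω≥0 (lookup S u) u v)))
        (λ not-fed → b<e*d⇒c≤a/d {a = inFromInside G S v} (degpos v) refl
                                  (deg⁻-split G S v) (≰⇒> not-fed)))

lemmaC3 : ∀ {n} (G : WDigraph n)
            → (∀ u v → E G u v ≡ true → ω G u v > 0ℚ)
            → (degpos : ∀ v → deg⁻ G v > 0ℚ)
            → (S : Subset n) → Nonempty S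
            → Ψ G degpos S ≤ ½ * (+ ∣ S ∣ / 1)
            → ∃ λ S′ → S′ ⊆ S × (+ ∣ S ∣ / 4) ≤ (+ ∣ S′ ∣ / 1)
                × (∀ s → s ∈ S′ → (+ 1 / 4) * deg⁻ G s ≤ inFromOutside G S s)
lemmaC3 G ω>0 degpos S _ Ψ≤½∣S∣ = S ∩ Fed , p∩q⊆p S Fed , ∣S∣/4≤∣S′∣ , fed
  where
  Fed : Subset _
  Fed = subsetOf (fedFromOutside? G S)
  ∣S∣/4≤∣S′∣ : + ∣ S ∣ / 4 ≤ fromℕ ∣ S ∩ Fed ∣
  ∣S∣/4≤∣S′∣ = subst (_≤ fromℕ ∣ S ∩ Fed ∣) (sym (k/4≡¼*k ∣ S ∣))
    (¼*x≤y {x = fromℕ ∣ S ∣} (fromℕ-nonNeg ∣ S ∩ Fed ∣)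
      (≤-trans (¾∣S∣≤Ψ+¾∣S∩fed∣ G (λ u v uv∈E → <⇒≤ (ω>0 u v uv∈E)) degpos S) (+-monoˡ-≤ _ Ψ≤½∣S∣)))
  fed : ∀ s → s ∈ S ∩ Fed → ¼ * deg⁻ G s ≤ inFromOutside G S s
  fed s s∈S′ = ∈-subsetOf⁻ (fedFromOutside? G S) (proj₂ (x∈p∩q⁻ S Fed s∈S′))
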